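{- Let $([c_\ell]_q)_{\ell\ge0}$ be an arbitrary sequence of numbers (the symbol $[c_\ell]_q$ just denotes the $\ell$-th term), and for $n,j\in\mathbb N$ let $F_q(n,j)=\sum_{\ell=0}^{n} q^{\ell-1} \binom{\ell}{j}_q[c_{\ell}]_q$. Then for all $n,p\in\mathbb N$, $$ \sum_{\ell=0}^{n} q^{\ell-1} ([\ell]_q)^{p} [c_{\ell}]_q=\sum_{\ell=0}^{p} q^{\binom{\ell}{2}} S_q(p,\ell)\, [\ell]_q!\, F_q(n,\ell)\,. $$
   Context: $q$ is a nonzero parameter (e.g. an indeterminate). $[n]_q=\frac{1-q^n}{1-q}=1+q+\dots+q^{n-1}$ (so $[0]_q=0$, and $([0]_q)^0=1$), $[n]_q!=[n]_q\cdots[1]_q$ with $[0]_q!=1$, $\binom{n}{k}_q=\frac{[n]_q!}{[k]_q![n-k]_q!}$ for $0\le k\le n$ and $0$ for $k>n$. $S_q(n,m)$ are Carlitz's $q$-Stirling numbers of the second kind: $S_q(n,0)=S_q(0,n)=\delta_{n0}$ for $n\ge0$ and $S_q(n+1,m)=S_q(n,m-1)+[m]_qS_q(n,m)$; they satisfy $([x]_q)^n=\sum_{m=0}^n q^{\binom m2}S_q(n,m)[x]_q[x-1]_q\cdots[x-m+1]_q$. -}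

module Defs where

open import Level using (Level)
open import Data.Nat using (ℕ; zero; suc)
open import Data.Nat.Combinatorics using (_C_)
open import Algebra.Bundles using (CommutativeRing)

module QDefs {a b : Level} (R : CommutativeRing a b) where
  open CommutativeRing R hiding (zero)

  pow : Carrier → ℕ → Carrier
  pow x zero    = 1#
  pow x (suc n) = x * pow x n

  sumTo : ℕ → (ℕ → Carrier) → Carrier
  sumTo zero    f = f zero
  sumTo (suc n) f = sumTo n f + f (suc n)

  qint : Carrier → ℕ → Carrier
  qint q zero    = 0#
  qint q (suc n) = qint q n + pow q n

  qfact : Carrier → ℕ → Carrier
  qfact q zero    = 1#
  qfact q (suc n) = qint q (suc n) * qfact q n

  qbinom : Carrier → ℕ → ℕ → Carrier
  qbinom q zero    zero    = 1#
  qbinom q zero    (suc k) = 0#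
  qbinom q (suc n) zero    = 1#
  qbinom q (suc n) (suc k) = qbinom q n k + pow q (suc k) * qbinom q n (suc k)

  -- Carlitz q-Stirling numbers of the second kind
  qStirling : Carrier → ℕ → ℕ → Carrier
  qStirling q zero    zero    = 1#
  qStirling q zero    (suc m) = 0#
  qStirling q (suc n) zero    = 0#
  qStirling q (suc n) (suc m) = qStirling q n m + qint q (suc m) * qStirling q n (suc m)

  -- q^{ℓ-1}, with q^{-1} = qinv for ℓ = 0
  powPred : Carrier → Carrier → ℕ → Carrier
  powPred q qinv zero    = qinv
  powPred q qinv (suc k) = pow q k

  F : Carrier → Carrier → (ℕ → Carrier) → ℕ → ℕ → Carrier
  F q qinv c n j = sumTo n (λ l → powPred q qinv l * qbinom q l j * c l)

  choose2 : ℕ → ℕ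
  choose2 l = l C 2

{-# OPTIONS --safe #-}
-- The q-integers have the "basis" e_m(ℓ) = q^(m choose 2) [m]_q! (ℓ choose m)_q, for which
-- multiplication by [ℓ]_q acts as  [ℓ]_q e_m = [m]_q e_m + e_(m+1)  (from the identity
-- [ℓ]_q (ℓ choose m)_q = [m]_q (ℓ choose m)_q + q^m [m+1]_q (ℓ choose m+1)_q).  This is exactly the
-- recurrence of Carlitz's q-Stirling numbers, so ([ℓ]_q)^p = Σ_m S_q(p,m) e_m(ℓ); multiplying by
-- q^(ℓ-1) [c_ℓ]_q, summing over ℓ and exchanging the two finite sums gives the theorem.
module Submission where

open import Defs
open import Level using (Level)
open import Data.Nat as ℕ using (ℕ; zero; suc; _<_; s≤s)
import Data.Nat.Properties as ℕₚ
open import Data.Nat.Combinatorics using (_C_; nC1≡n; nCk+nC[k+1]≡[n+1]C[k+1])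
open import Algebra.Bundles using (CommutativeRing)
import Algebra.Solver.Ring.NaturalCoefficients.Default as NaturalCoefficients
open import Relation.Binary.PropositionalEquality as ≡ using (_≡_)
import Relation.Binary.Reasoning.Setoid as SetoidReasoning

[1+m]C2≡mC2+m : ∀ m → suc m C 2 ≡ m C 2 ℕ.+ m
[1+m]C2≡mC2+m m = begin
  suc m C 2         ≡⟨ ≡.sym (nCk+nC[k+1]≡[n+1]C[k+1] m 1) ⟩
  m C 1 ℕ.+ m C 2   ≡⟨ ≡.cong (ℕ._+ m C 2) (nC1≡n m) ⟩
  m ℕ.+ m C 2       ≡⟨ ℕₚ.+-comm m (m C 2) ⟩
  m C 2 ℕ.+ m       ∎
  where open ≡.≡-Reasoning

module QIdentities {a b : Level} (R : CommutativeRing a b) where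
  open CommutativeRing R hiding (zero)
  open QDefs R
  open NaturalCoefficients commutativeSemiring using (solve; _:=_; _:+_; _:*_)
  open SetoidReasoning setoid
  open import Algebra.Properties.CommutativeSemigroup *-commutativeSemigroup using (x∙yz≈y∙xz)

  sumTo-cong : ∀ n {f g : ℕ → Carrier} → (∀ l → f l ≈ g l) → sumTo n f ≈ sumTo n g
  sumTo-cong zero    f≈g = f≈g 0
  sumTo-cong (suc n) f≈g = +-cong (sumTo-cong n f≈g) (f≈g (suc n))

  sumTo-+ : ∀ n (f g : ℕ → Carrier) → sumTo n (λ l → f l + g l) ≈ sumTo n f + sumTo n g
  sumTo-+ zero    f g = refl
  sumTo-+ (suc n) f g = begin
      sumTo n (λ l → f l + g l) + (f (suc n) + g (suc n))
    ≈⟨ +-congʳ (sumTo-+ n f g) ⟩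
      (sumTo n f + sumTo n g) + (f (suc n) + g (suc n))
    ≈⟨ solve 4 (λ x y z w → (x :+ y) :+ (z :+ w) := (x :+ z) :+ (y :+ w)) refl _ _ _ _ ⟩
      (sumTo n f + f (suc n)) + (sumTo n g + g (suc n)) ∎

  sumTo-*ˡ : ∀ n x (f : ℕ → Carrier) → x * sumTo n f ≈ sumTo n (λ l → x * f l)
  sumTo-*ˡ zero    x f = refl
  sumTo-*ˡ (suc n) x f = trans (distribˡ x _ _) (+-congʳ (sumTo-*ˡ n x f))

  sumTo-*ʳ : ∀ n x (f : ℕ → Carrier) → sumTo n f * x ≈ sumTo n (λ l → f l * x)
  sumTo-*ʳ zero    x f = refl
  sumTo-*ʳ (suc n) x f = trans (distribʳ x _ _) (+-congʳ (sumTo-*ʳ n x f))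

  sumTo-swap : ∀ n p (g : ℕ → ℕ → Carrier) →
    sumTo n (λ l → sumTo p (g l)) ≈ sumTo p (λ m → sumTo n (λ l → g l m))
  sumTo-swap zero    p g = refl
  sumTo-swap (suc n) p g = trans (+-congʳ (sumTo-swap n p g)) (sym (sumTo-+ p _ _))

  sumTo-suc-head : ∀ n (f : ℕ → Carrier) → sumTo (suc n) f ≈ f 0 + sumTo n (λ l → f (suc l))
  sumTo-suc-head zero    f = refl
  sumTo-suc-head (suc n) f = trans (+-congʳ (sumTo-suc-head n f)) (+-assoc _ _ _)

  sumTo-shift : ∀ n (f : ℕ → Carrier) → f 0 ≈ 0# → f (suc n) ≈ 0# →
    sumTo n (λ l → f (suc l)) ≈ sumTo n f
  sumTo-shift n f f0≈0 f[1+n]≈0 = begin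
    sumTo n (λ l → f (suc l))        ≈⟨ sym (+-identityˡ _) ⟩
    0# + sumTo n (λ l → f (suc l))   ≈⟨ +-congʳ (sym f0≈0) ⟩
    f 0 + sumTo n (λ l → f (suc l))  ≈⟨ sym (sumTo-suc-head n f) ⟩
    sumTo n f + f (suc n)            ≈⟨ +-congˡ f[1+n]≈0 ⟩
    sumTo n f + 0#                   ≈⟨ +-identityʳ _ ⟩
    sumTo n f                        ∎

  pow-+ : ∀ x m n → pow x (m ℕ.+ n) ≈ pow x m * pow x n
  pow-+ x zero    n = sym (*-identityˡ _)
  pow-+ x (suc m) n = trans (*-congˡ (pow-+ x m n)) (sym (*-assoc _ _ _))

  module _ (q : Carrier) where

    qint-suc : ∀ n → qint q (suc n) ≈ 1# + q * qint q n
    qint-suc zero = begin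
      0# + 1#      ≈⟨ +-comm _ _ ⟩
      1# + 0#      ≈⟨ +-congˡ (sym (zeroʳ q)) ⟩
      1# + q * 0#  ∎
    qint-suc (suc n) = begin
        qint q (suc n) + q * pow q n
      ≈⟨ +-congʳ (qint-suc n) ⟩
        (1# + q * qint q n) + q * pow q n
      ≈⟨ solve 4 (λ o x y z → (o :+ x :* y) :+ x :* z := o :+ x :* (y :+ z)) refl 1# q _ _ ⟩
        1# + q * (qint q n + pow q n) ∎

    qbinom-0 : ∀ l → qbinom q l 0 ≈ 1#
    qbinom-0 zero    = refl
    qbinom-0 (suc l) = refl

    qbinom-1 : ∀ l → qbinom q l 1 ≈ qint q l
    qbinom-1 zero    = refl
    qbinom-1 (suc l) = begin
      qbinom q l 0 + q * 1# * qbinom q l 1  ≈⟨ +-cong (qbinom-0 l) (*-cong (*-identityʳ q) (qbinom-1 l)) ⟩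
      1# + q * qint q l                     ≈⟨ sym (qint-suc l) ⟩
      qint q (suc l)                        ∎

    qStirling-above-diagonal : ∀ {p m} → p < m → qStirling q p m ≈ 0#
    qStirling-above-diagonal {zero}  {suc m} _       = refl
    qStirling-above-diagonal {suc p} {suc m} (s≤s p<m) = begin
        qStirling q p m + qint q (suc m) * qStirling q p (suc m)
      ≈⟨ +-cong (qStirling-above-diagonal p<m)
                (*-congˡ (qStirling-above-diagonal (ℕₚ.m<n⇒m<1+n p<m))) ⟩
        0# + qint q (suc m) * 0#
      ≈⟨ trans (+-identityˡ _) (zeroʳ _) ⟩
        0# ∎

    qint-*-qbinom : ∀ l m → qint q l * qbinom q l m
                          ≈ qint q m * qbinom q l m
                            + pow q m * (qint q (suc m) * qbinom q l (suc m))
    qint-*-qbinom zero zero = begin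
      0# * 1#                      ≈⟨ sym (+-identityʳ _) ⟩
      0# * 1# + 0#                 ≈⟨ +-congˡ (sym (trans (*-congˡ (zeroʳ _)) (zeroʳ _))) ⟩
      0# * 1# + 1# * (_ * 0#)      ∎
    qint-*-qbinom zero (suc m) = begin
      0# * 0#                                  ≈⟨ zeroʳ _ ⟩
      0#                                       ≈⟨ sym (+-identityʳ _) ⟩
      0# + 0#                                  ≈⟨ sym (+-cong (zeroʳ _) (trans (*-congˡ (zeroʳ _)) (zeroʳ _))) ⟩
      _ * 0# + pow q (suc m) * (_ * 0#)        ∎
    qint-*-qbinom (suc l) zero = begin
      qint q (suc l) * 1#                          ≈⟨ *-identityʳ _ ⟩
      qint q (suc l)                               ≈⟨ sym (qbinom-1 (suc l)) ⟩
      qbinom q (suc l) 1                           ≈⟨ sym (*-identityˡ _) ⟩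
      1# * qbinom q (suc l) 1                      ≈⟨ *-congʳ (sym (+-identityˡ _)) ⟩
      (0# + 1#) * qbinom q (suc l) 1               ≈⟨ sym (*-identityˡ _) ⟩
      1# * ((0# + 1#) * qbinom q (suc l) 1)        ≈⟨ sym (+-identityˡ _) ⟩
      0# + 1# * ((0# + 1#) * qbinom q (suc l) 1)   ≈⟨ +-congʳ (sym (zeroˡ _)) ⟩
      0# * 1# + 1# * ((0# + 1#) * qbinom q (suc l) 1) ∎
    qint-*-qbinom (suc l) (suc m) = begin
        qint q (suc l) * (b₀ + q * Q * b₁)
      ≈⟨ *-congʳ (qint-suc l) ⟩
        (1# + q * L) * (b₀ + q * Q * b₁)
      ≈⟨ solve 6 (λ o q L Q b₀ b₁ →
                   (o :+ q :* L) :* (b₀ :+ q :* Q :* b₁)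
                   := o :* (b₀ :+ q :* Q :* b₁) :+ q :* (L :* b₀) :+ q :* (q :* Q) :* (L :* b₁))
                 refl 1# q L Q b₀ b₁ ⟩
        1# * (b₀ + q * Q * b₁) + q * (L * b₀) + q * (q * Q) * (L * b₁)
      ≈⟨ +-cong (+-congˡ (*-congˡ (qint-*-qbinom l m))) (*-congˡ (qint-*-qbinom l (suc m))) ⟩
        1# * (b₀ + q * Q * b₁) + q * (M * b₀ + Q * (N * b₁)) + q * (q * Q) * (N * b₁ + q * Q * (P * b₂))
      ≈⟨ solve 9 (λ o q M Q N P b₀ b₁ b₂ →
                   o :* (b₀ :+ q :* Q :* b₁) :+ q :* (M :* b₀ :+ Q :* (N :* b₁))
                     :+ q :* (q :* Q) :* (N :* b₁ :+ q :* Q :* (P :* b₂))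
                   := (o :+ q :* M) :* b₀
                        :+ q :* Q :* (N :* b₁ :+ ((o :+ q :* N) :* b₁ :+ P :* (q :* (q :* Q) :* b₂))))
                 refl 1# q M Q N P b₀ b₁ b₂ ⟩
        (1# + q * M) * b₀ + q * Q * (N * b₁ + ((1# + q * N) * b₁ + P * (q * (q * Q) * b₂)))
      ≈⟨ +-cong (*-congʳ (sym (qint-suc m)))
                (*-congˡ (+-congˡ (+-congʳ (*-congʳ (sym (qint-suc (suc m))))))) ⟩
        N * b₀ + q * Q * (N * b₁ + (P * b₁ + P * (q * (q * Q) * b₂)))
      ≈⟨ solve 7 (λ q Q N P b₀ b₁ b₂ →
                   N :* b₀ :+ q :* Q :* (N :* b₁ :+ (P :* b₁ :+ P :* (q :* (q :* Q) :* b₂)))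
                   := N :* (b₀ :+ q :* Q :* b₁) :+ q :* Q :* (P :* (b₁ :+ q :* (q :* Q) :* b₂)))
                 refl q Q N P b₀ b₁ b₂ ⟩
        N * (b₀ + q * Q * b₁) + q * Q * (P * (b₁ + q * (q * Q) * b₂)) ∎
      where
      L M N P Q b₀ b₁ b₂ : Carrier
      L = qint q l
      M = qint q m
      N = qint q (suc m)
      P = qint q (suc (suc m))
      Q = pow q m
      b₀ = qbinom q l m
      b₁ = qbinom q l (suc m)
      b₂ = qbinom q l (suc (suc m))

    pow-qStirling-expansion : ∀ x (e : ℕ → Carrier) → e 0 ≈ 1# →
      (∀ m → x * e m ≈ qint q m * e m + e (suc m)) →
      ∀ p → pow x p ≈ sumTo p (λ m → qStirling q p m * e m)
    pow-qStirling-expansion x e e0≈1 x*e≈ zero = sym (trans (*-identityˡ _) e0≈1)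
    pow-qStirling-expansion x e e0≈1 x*e≈ (suc p) = begin
        x * pow x p
      ≈⟨ *-congˡ (pow-qStirling-expansion x e e0≈1 x*e≈ p) ⟩
        x * sumTo p (λ m → S m * e m)
      ≈⟨ trans (sumTo-*ˡ p x _) (sumTo-cong p x*S*e≈) ⟩
        sumTo p (λ m → qint q m * S m * e m + S m * e (suc m))
      ≈⟨ trans (sumTo-+ p _ _) (+-comm _ _) ⟩
        sumTo p (λ m → S m * e (suc m)) + sumTo p (λ m → qint q m * S m * e m)
      ≈⟨ +-congˡ (sym (sumTo-shift p weighted weighted-0 weighted-[1+p])) ⟩
        sumTo p (λ m → S m * e (suc m)) + sumTo p (λ m → qint q (suc m) * S (suc m) * e (suc m))
      ≈⟨ sym (trans (sumTo-cong p (λ m → distribʳ _ _ _)) (sumTo-+ p _ _)) ⟩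
        sumTo p (λ m → (S m + qint q (suc m) * S (suc m)) * e (suc m))
      ≈⟨ sym (+-identityˡ _) ⟩
        0# + sumTo p (λ m → qStirling q (suc p) (suc m) * e (suc m))
      ≈⟨ +-congʳ (sym (zeroˡ _)) ⟩
        0# * e 0 + sumTo p (λ m → qStirling q (suc p) (suc m) * e (suc m))
      ≈⟨ sym (sumTo-suc-head p _) ⟩
        sumTo (suc p) (λ m → qStirling q (suc p) m * e m) ∎
      where
      S : ℕ → Carrier
      S = qStirling q p

      weighted : ℕ → Carrier
      weighted m = qint q m * S m * e m

      weighted-0 : weighted 0 ≈ 0#
      weighted-0 = trans (*-congʳ (zeroˡ _)) (zeroˡ _)

      weighted-[1+p] : weighted (suc p) ≈ 0#
      weighted-[1+p] =
        trans (*-congʳ (trans (*-congˡ (qStirling-above-diagonal (ℕₚ.n<1+n p))) (zeroʳ _))) (zeroˡ _)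

      x*S*e≈ : ∀ m → x * (S m * e m) ≈ qint q m * S m * e m + S m * e (suc m)
      x*S*e≈ m = begin
        x * (S m * e m)                            ≈⟨ x∙yz≈y∙xz _ _ _ ⟩
        S m * (x * e m)                            ≈⟨ *-congˡ (x*e≈ m) ⟩
        S m * (qint q m * e m + e (suc m))         ≈⟨ distribˡ _ _ _ ⟩
        S m * (qint q m * e m) + S m * e (suc m)   ≈⟨ +-congʳ (trans (x∙yz≈y∙xz _ _ _) (sym (*-assoc _ _ _))) ⟩
        qint q m * S m * e m + S m * e (suc m)     ∎

    qbinomBasis : ℕ → ℕ → Carrier
    qbinomBasis l m = pow q (choose2 m) * qfact q m * qbinom q l m

    qint-*-qbinomBasis : ∀ l m →
      qint q l * qbinomBasis l m ≈ qint q m * qbinomBasis l m + qbinomBasis l (suc m)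
    qint-*-qbinomBasis l m = begin
        qint q l * (E * [m]! * B)
      ≈⟨ x∙yz≈y∙xz _ _ _ ⟩
        E * [m]! * (qint q l * B)
      ≈⟨ *-congˡ (qint-*-qbinom l m) ⟩
        E * [m]! * (qint q m * B + Q * (N * B′))
      ≈⟨ solve 7 (λ E F M B Q N B′ →
                   E :* F :* (M :* B :+ Q :* (N :* B′)) := M :* (E :* F :* B) :+ E :* Q :* (N :* F) :* B′)
                 refl E [m]! (qint q m) B Q N B′ ⟩
        qint q m * (E * [m]! * B) + E * Q * (N * [m]!) * B′
      ≈⟨ +-congˡ (*-congʳ (*-congʳ (sym E′≈E*Q))) ⟩
        qint q m * qbinomBasis l m + qbinomBasis l (suc m) ∎
      where
      E [m]! B Q N B′ : Carrier
      E = pow q (choose2 m)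
      [m]! = qfact q m
      B = qbinom q l m
      Q = pow q m
      N = qint q (suc m)
      B′ = qbinom q l (suc m)
      E′≈E*Q : pow q (choose2 (suc m)) ≈ E * Q
      E′≈E*Q = trans (reflexive (≡.cong (pow q) ([1+m]C2≡mC2+m m))) (pow-+ q (m C 2) m)

    pow-qint-expansion : ∀ l p → pow (qint q l) p ≈ sumTo p (λ m → qStirling q p m * qbinomBasis l m)
    pow-qint-expansion l =
      pow-qStirling-expansion (qint q l) (qbinomBasis l)
        (trans (*-congʳ (*-identityʳ _)) (trans (*-identityˡ _) (qbinom-0 l))) (qint-*-qbinomBasis l)

lemma2 : {a b : Level} (R : CommutativeRing a b) →
    let open CommutativeRing R
        open QDefs R
    in (q qinv : Carrier) → q * qinv ≈ 1# →
       (c : ℕ → Carrier) (n p : ℕ) →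
       sumTo n (λ l → powPred q qinv l * pow (qint q l) p * c l)
         ≈ sumTo p (λ l → pow q (choose2 l) * qStirling q p l * qfact q l * F q qinv c n l)
lemma2 R q qinv _ c n p = begin
    sumTo n (λ l → w l * pow (qint q l) p * c l)
  ≈⟨ sumTo-cong n (λ l → *-congʳ (*-congˡ (pow-qint-expansion q l p))) ⟩
    sumTo n (λ l → w l * sumTo p (λ m → qStirling q p m * qbinomBasis q l m) * c l)
  ≈⟨ sumTo-cong n (λ l → trans (*-congʳ (sumTo-*ˡ p _ _)) (sumTo-*ʳ p _ _)) ⟩
    sumTo n (λ l → sumTo p (λ m → w l * (qStirling q p m * qbinomBasis q l m) * c l))
  ≈⟨ sumTo-cong n (λ l → sumTo-cong p (λ m →
       solve 6 (λ w E S G B c → w :* (S :* (E :* G :* B)) :* c := E :* S :* G :* (w :* B :* c))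
             refl (w l) (pow q (choose2 m)) (qStirling q p m) (qfact q m) (qbinom q l m) (c l))) ⟩
    sumTo n (λ l → sumTo p (λ m → coefficient m * (w l * qbinom q l m * c l)))
  ≈⟨ sumTo-swap n p _ ⟩
    sumTo p (λ m → sumTo n (λ l → coefficient m * (w l * qbinom q l m * c l)))
  ≈⟨ sumTo-cong p (λ m → sym (sumTo-*ˡ n _ _)) ⟩
    sumTo p (λ m → coefficient m * F q qinv c n m) ∎
  where
  open CommutativeRing R hiding (zero)
  open QDefs R
  open QIdentities R
  open NaturalCoefficients commutativeSemiring using (solve; _:=_; _:*_)
  open SetoidReasoning setoid
  w : ℕ → Carrier
  w = powPred q qinv
  coefficient : ℕ → Carrier
  coefficient m = pow q (choose2 m) * qStirling q p m * qfact q m
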